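{- For non-negative integers $M_1,M_2$, \[ \sum_{r_1=0}^{M_1}\sum_{r_2=0}^{M_2}\frac{a^{r_1}b^{r_2}q^{r_1^2-r_1r_2+r_2^2}}{(q;q)_{M_1-r_1}(q;q)_{M_2-r_2}}\,\frac{(abq;q)_{r_1+r_2}}{(q,aq,abq;q)_{r_1}(q,bq,abq;q)_{r_2}} =\frac{(abq;q)_{M_1+M_2}}{(q,aq,abq;q)_{M_1}(q,bq,abq;q)_{M_2}}. \]
   Context: $(a;q)_0=1$, $(a;q)_n=\prod_{i=1}^n(1-aq^{i-1})$, and $(a_1,\dots,a_k;q)_n=(a_1;q)_n\cdots(a_k;q)_n$. -}

module Defs where

open import Data.Nat as ℕ using (ℕ; zero; suc; _∸_)
open import Data.Rational using (ℚ; 0ℚ; 1ℚ; _+_; _*_; _-_; 1/_; ≢-nonZero)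
open import Data.Rational.Properties using (_≟_)
open import Relation.Nullary using (yes; no)

pow : ℚ → ℕ → ℚ
pow x zero    = 1ℚ
pow x (suc n) = x * pow x n

poch : ℚ → ℚ → ℕ → ℚ
poch a q zero    = 1ℚ
poch a q (suc n) = poch a q n * (1ℚ - a * pow q n)

-- total inverse (inv 0 = 0); only ever applied to nonzero values
-- in the statement, guaranteed by hypotheses
inv : ℚ → ℚ
inv p with p ≟ 0ℚ
... | yes _ = 0ℚ
... | no ne = 1/_ p {{≢-nonZero ne}}

sumTo : ℕ → (ℕ → ℚ) → ℚ
sumTo zero    f = f 0
sumTo (suc M) f = sumTo M f + f (suc M)

-- exponent r1^2 - r1 r2 + r2^2 (always ≥ 0, so truncated subtraction is exact)
qexp : ℕ → ℕ → ℕ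
qexp r₁ r₂ = (r₁ ℕ.* r₁ ℕ.+ r₂ ℕ.* r₂) ∸ r₁ ℕ.* r₂

term : ℚ → ℚ → ℚ → ℕ → ℕ → ℕ → ℕ → ℚ
term a b q M₁ M₂ r₁ r₂ =
  (pow a r₁ * pow b r₂ * pow q (qexp r₁ r₂))
  * inv (poch q q (M₁ ∸ r₁) * poch q q (M₂ ∸ r₂))
  * (poch (a * b * q) q (r₁ ℕ.+ r₂)
     * inv (poch q q r₁ * poch (a * q) q r₁ * poch (a * b * q) q r₁
            * (poch q q r₂ * poch (b * q) q r₂ * poch (a * b * q) q r₂)))

lhs : ℚ → ℚ → ℚ → ℕ → ℕ → ℚ
lhs a b q M₁ M₂ = sumTo M₁ (λ r₁ → sumTo M₂ (λ r₂ → term a b q M₁ M₂ r₁ r₂))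

rhs : ℚ → ℚ → ℚ → ℕ → ℕ → ℚ
rhs a b q M₁ M₂ =
  poch (a * b * q) q (M₁ ℕ.+ M₂)
  * inv (poch q q M₁ * poch (a * q) q M₁ * poch (a * b * q) q M₁
         * (poch q q M₂ * poch (b * q) q M₂ * poch (a * b * q) q M₂))

-- Multiplying by the common denominator turns the identity into a polynomial one: writing [n k]
-- for the q-binomial coefficient and (x)_n for (x;q)_n,
--   Σ_{r₁ ≤ M₁} Σ_{r₂ ≤ M₂} [M₁ r₁] [M₂ r₂] a^r₁ b^r₂ q^(r₁² - r₁r₂ + r₂²) (abq)_{r₁+r₂}
--       · (aq^(r₁+1))_{M₁-r₁} (abq^(r₁+1))_{M₁-r₁} (bq^(r₂+1))_{M₂-r₂} (abq^(r₂+1))_{M₂-r₂}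
--     = (abq)_{M₁+M₂}.
-- Fix r₁ = s and split (abq)_{s+r₂} = (abq)_s (abq^(s+1))_{r₂}; the sum over r₂ of the factors
-- depending on r₂ equals
--   Σ_k [M₂ k] (q^(s-k+1))_k b^k q^(s² - sk + k²) (abq^(k+1))_{M₂-k},
-- because both sums satisfy the same recurrence in M₂, obtained from the q-Pascal rule.
-- After exchanging the order of summation, the sum over s is a q-analogue of the k-th factorial
-- moment of a binomial distribution and equals (q^(M₁-k+1))_k a^k q^(k²). The remaining sum over k
-- is a q-Chu–Vandermonde sum with value (abq^(M₁+1))_{M₂}, and (abq)_{M₁} (abq^(M₁+1))_{M₂} = (abq)_{M₁+M₂}.
module Submission where

open import Data.Nat.Base as ℕ using (ℕ; zero; suc; _∸_; _≤_; _<_; z≤n; s≤s)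
import Data.Nat.Properties as ℕ
import Data.Nat.Tactic.RingSolver as ℕ-Solver
open import Data.Rational.Base using (ℚ; 0ℚ; 1ℚ; _+_; _*_; _-_; -_; ≢-nonZero)
open import Data.Rational.Properties
  using ( _≟_; +-*-commutativeRing; +-assoc; *-assoc; *-comm; *-zeroˡ; *-zeroʳ; *-identityˡ; *-identityʳ
        ; *-distribˡ-+; +-identityˡ; +-identityʳ; *-inverseʳ)
open import Data.Sum.Base using (inj₁; inj₂)
open import Level using (0ℓ)
open import Relation.Binary.PropositionalEquality
open import Relation.Nullary.Decidable using (Dec; yes; no; dec⇒maybe)
open import Relation.Nullary.Negation using (contradiction)
import Tactic.RingSolver.Core.AlmostCommutativeRing as ACR
open import Tactic.RingSolver using (solve-∀)

open import Defs

open ≡-Reasoning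

ℚ-ring : ACR.AlmostCommutativeRing 0ℓ 0ℓ
ℚ-ring = ACR.fromCommutativeRing +-*-commutativeRing (λ x → dec⇒maybe (0ℚ ≟ x))

cong₃ : (f : ℚ → ℚ → ℚ → ℚ) {x x′ y y′ z z′ : ℚ} → x ≡ x′ → y ≡ y′ → z ≡ z′ → f x y z ≡ f x′ y′ z′
cong₃ f refl refl refl = refl

sumTo-cong : ∀ N {f g : ℕ → ℚ} → (∀ i → i ≤ N → f i ≡ g i) → sumTo N f ≡ sumTo N g
sumTo-cong zero    f≗g = f≗g 0 z≤n
sumTo-cong (suc N) f≗g =
  cong₂ _+_ (sumTo-cong N (λ i i≤N → f≗g i (ℕ.m≤n⇒m≤1+n i≤N))) (f≗g (suc N) ℕ.≤-refl)

sumTo-+ : ∀ N (f g : ℕ → ℚ) → sumTo N (λ i → f i + g i) ≡ sumTo N f + sumTo N g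
sumTo-+ zero    f g = refl
sumTo-+ (suc N) f g = trans (cong (_+ (f (suc N) + g (suc N))) (sumTo-+ N f g))
                            (interchange (sumTo N f) (sumTo N g) (f (suc N)) (g (suc N)))
  where
  interchange : ∀ a b c d → (a + b) + (c + d) ≡ (a + c) + (b + d)
  interchange = solve-∀ ℚ-ring

sumTo-*ˡ : ∀ N c (f : ℕ → ℚ) → sumTo N (λ i → c * f i) ≡ c * sumTo N f
sumTo-*ˡ zero    c f = refl
sumTo-*ˡ (suc N) c f = trans (cong (_+ c * f (suc N)) (sumTo-*ˡ N c f)) (sym (*-distribˡ-+ c _ _))

sumTo-factor : ∀ N c {f g : ℕ → ℚ} → (∀ i → i ≤ N → f i ≡ c * g i) → sumTo N f ≡ c * sumTo N g
sumTo-factor N c f≗cg = trans (sumTo-cong N f≗cg) (sumTo-*ˡ N c _)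

sumTo-comm : ∀ M N (f : ℕ → ℕ → ℚ) →
             sumTo M (λ i → sumTo N (f i)) ≡ sumTo N (λ j → sumTo M (λ i → f i j))
sumTo-comm zero    N f = refl
sumTo-comm (suc M) N f = trans (cong (_+ sumTo N (f (suc M))) (sumTo-comm M N f))
                               (sym (sumTo-+ N _ (f (suc M))))

sumTo-unfoldˡ : ∀ N (f : ℕ → ℚ) → sumTo (suc N) f ≡ f 0 + sumTo N (λ i → f (suc i))
sumTo-unfoldˡ zero    f = refl
sumTo-unfoldˡ (suc N) f = trans (cong (_+ f (suc (suc N))) (sumTo-unfoldˡ N f)) (+-assoc (f 0) _ _)

sumTo-head : ∀ N (f : ℕ → ℚ) → (∀ i → f (suc i) ≡ 0ℚ) → sumTo N f ≡ f 0
sumTo-head zero    f tail≡0 = refl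
sumTo-head (suc N) f tail≡0 = trans (cong₂ _+_ (sumTo-head N f tail≡0) (tail≡0 N)) (+-identityʳ _)

sumTo-zero : ∀ N (f : ℕ → ℚ) → (∀ i → f i ≡ 0ℚ) → sumTo N f ≡ 0ℚ
sumTo-zero N f f≡0 = trans (sumTo-head N f (λ i → f≡0 (suc i))) (f≡0 0)

pow-+ : ∀ x m n → pow x (m ℕ.+ n) ≡ pow x m * pow x n
pow-+ x zero    n = sym (*-identityˡ _)
pow-+ x (suc m) n = trans (cong (x *_) (pow-+ x m n)) (sym (*-assoc x _ _))

pow-+₃ : ∀ x {m} a b c → m ≡ a ℕ.+ b ℕ.+ c → pow x m ≡ pow x a * pow x b * pow x c
pow-+₃ x a b c refl = trans (pow-+ x (a ℕ.+ b) c) (cong (_* pow x c) (pow-+ x a b))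

pow-* : ∀ x y n → pow (x * y) n ≡ pow x n * pow y n
pow-* x y zero    = refl
pow-* x y (suc n) = trans (cong (x * y *_) (pow-* x y n)) (interchange x y _ _)
  where
  interchange : ∀ a b c d → (a * b) * (c * d) ≡ (a * c) * (b * d)
  interchange = solve-∀ ℚ-ring

pow-∸ : ∀ x {m n} → m ≤ n → pow x m * pow x (n ∸ m) ≡ pow x n
pow-∸ x {m} {n} m≤n = trans (sym (pow-+ x m (n ∸ m))) (cong (pow x) (ℕ.m+[n∸m]≡n m≤n))

pow-∸-suc : ∀ x {m n} → m ≤ n → pow x (n ∸ m) * pow x (suc m) ≡ pow x (suc n)
pow-∸-suc x {m} {n} m≤n = trans (regroup x (pow x m) (pow x (n ∸ m))) (cong (x *_) (pow-∸ x m≤n))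
  where
  regroup : ∀ a b c → c * (a * b) ≡ a * (b * c)
  regroup = solve-∀ ℚ-ring

poch-+ : ∀ x q m n → poch x q (m ℕ.+ n) ≡ poch x q m * poch (x * pow q m) q n
poch-+ x q m zero    = trans (cong (poch x q) (ℕ.+-identityʳ m)) (sym (*-identityʳ _))
poch-+ x q m (suc n) = begin
  poch x q (m ℕ.+ suc n)                                      ≡⟨ cong (poch x q) (ℕ.+-suc m n) ⟩
  poch x q (m ℕ.+ n) * (1ℚ - x * pow q (m ℕ.+ n))             ≡⟨ cong₂ (λ u v → u * (1ℚ - x * v))
                                                                       (poch-+ x q m n) (pow-+ q m n) ⟩
  poch x q m * poch y q n * (1ℚ - x * (pow q m * pow q n))    ≡⟨ regroup (poch x q m) (poch y q n) x (pow q m) (pow q n) ⟩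
  poch x q m * (poch y q n * (1ℚ - y * pow q n))              ∎
  where
  y = x * pow q m
  regroup : ∀ a b c d e → a * b * (1ℚ - c * (d * e)) ≡ a * (b * (1ℚ - c * d * e))
  regroup = solve-∀ ℚ-ring

poch-∸ : ∀ x q {m n} → m ≤ n → poch x q m * poch (x * pow q m) q (n ∸ m) ≡ poch x q n
poch-∸ x q {m} {n} m≤n = trans (sym (poch-+ x q m (n ∸ m))) (cong (poch x q) (ℕ.m+[n∸m]≡n m≤n))

poch-sucˡ : ∀ x q n → poch x q (suc n) ≡ (1ℚ - x) * poch (x * q) q n
poch-sucˡ x q n = trans (poch-+ x q 1 n) (cong₂ (λ u v → u * poch v q n) (first-factor x) (x*q¹ x q))
  where
  first-factor : ∀ a → 1ℚ * (1ℚ - a * 1ℚ) ≡ 1ℚ - a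
  first-factor = solve-∀ ℚ-ring
  x*q¹ : ∀ a b → a * (b * 1ℚ) ≡ a * b
  x*q¹ = solve-∀ ℚ-ring

poch-∸-sucʳ : ∀ x q {m n} → m ≤ n →
              poch (x * pow q m) q (suc n ∸ m) ≡ poch (x * pow q m) q (n ∸ m) * (1ℚ - x * pow q n)
poch-∸-sucʳ x q {m} {n} m≤n = begin
  poch y q (suc n ∸ m)                          ≡⟨ cong (poch y q) (ℕ.+-∸-assoc 1 m≤n) ⟩
  poch y q (n ∸ m) * (1ℚ - y * pow q (n ∸ m))   ≡⟨ cong (λ z → poch y q (n ∸ m) * (1ℚ - z)) y*qⁿ⁻ᵐ≡x*qⁿ ⟩
  poch y q (n ∸ m) * (1ℚ - x * pow q n)         ∎
  where
  y = x * pow q m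
  y*qⁿ⁻ᵐ≡x*qⁿ : y * pow q (n ∸ m) ≡ x * pow q n
  y*qⁿ⁻ᵐ≡x*qⁿ = trans (*-assoc x _ _) (cong (x *_) (pow-∸ q m≤n))

inv-inverseʳ : ∀ {x} → x ≢ 0ℚ → x * inv x ≡ 1ℚ
inv-inverseʳ {x} x≢0 with x ≟ 0ℚ
... | yes x≡0 = contradiction x≡0 x≢0
... | no  x≢0 = *-inverseʳ x {{≢-nonZero x≢0}}

inv-zero : ∀ {x} → x ≡ 0ℚ → inv x ≡ 0ℚ
inv-zero refl = refl

*-cancelˡ : ∀ {x y z} → x ≢ 0ℚ → x * y ≡ x * z → y ≡ z
*-cancelˡ {x} {y} {z} x≢0 xy≡xz =
  trans (sym (inv-cancels y)) (trans (cong (inv x *_) xy≡xz) (inv-cancels z))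
  where
  inv-cancels : ∀ w → inv x * (x * w) ≡ w
  inv-cancels w = begin
    inv x * (x * w)   ≡⟨ sym (*-assoc (inv x) x w) ⟩
    inv x * x * w     ≡⟨ cong (_* w) (trans (*-comm (inv x) x) (inv-inverseʳ x≢0)) ⟩
    1ℚ * w            ≡⟨ *-identityˡ w ⟩
    w                 ∎

*-≢0 : ∀ {x y} → x ≢ 0ℚ → y ≢ 0ℚ → x * y ≢ 0ℚ
*-≢0 {x} {y} x≢0 y≢0 xy≡0 = x≢0 (begin
  x                 ≡⟨ sym (*-identityʳ x) ⟩
  x * 1ℚ            ≡⟨ cong (x *_) (sym (inv-inverseʳ y≢0)) ⟩
  x * (y * inv y)   ≡⟨ sym (*-assoc x y (inv y)) ⟩
  x * y * inv y     ≡⟨ cong (_* inv y) xy≡0 ⟩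
  0ℚ * inv y        ≡⟨ *-zeroˡ (inv y) ⟩
  0ℚ                ∎)

inv-unique : ∀ {x y d} → x * y ≡ d → d ≢ 0ℚ → inv x ≡ y * inv d
inv-unique {x} {y} {d} xy≡d d≢0 = *-cancelˡ x≢0 (begin
  x * inv x         ≡⟨ inv-inverseʳ x≢0 ⟩
  1ℚ                ≡⟨ sym (inv-inverseʳ d≢0) ⟩
  d * inv d         ≡⟨ cong (_* inv d) (sym xy≡d) ⟩
  x * y * inv d     ≡⟨ *-assoc x y (inv d) ⟩
  x * (y * inv d)   ∎)
  where
  x≢0 : x ≢ 0ℚ
  x≢0 x≡0 = d≢0 (trans (sym xy≡d) (trans (cong (_* y) x≡0) (*-zeroˡ y)))

inv-* : ∀ x y → inv (x * y) ≡ inv x * inv y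
inv-* x y = by-cases (x ≟ 0ℚ) (y ≟ 0ℚ)
  where
  by-cases : Dec (x ≡ 0ℚ) → Dec (y ≡ 0ℚ) → inv (x * y) ≡ inv x * inv y
  by-cases (yes x≡0) _ = begin
    inv (x * y)    ≡⟨ inv-zero (trans (cong (_* y) x≡0) (*-zeroˡ y)) ⟩
    0ℚ             ≡⟨ sym (*-zeroˡ (inv y)) ⟩
    0ℚ * inv y     ≡⟨ cong (_* inv y) (sym (inv-zero x≡0)) ⟩
    inv x * inv y  ∎
  by-cases (no _) (yes y≡0) = begin
    inv (x * y)    ≡⟨ inv-zero (trans (cong (x *_) y≡0) (*-zeroʳ x)) ⟩
    0ℚ             ≡⟨ sym (*-zeroʳ (inv x)) ⟩
    inv x * 0ℚ     ≡⟨ cong (inv x *_) (sym (inv-zero y≡0)) ⟩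
    inv x * inv y  ∎
  by-cases (no x≢0) (no y≢0) = trans (inv-unique {x * y} xy*x⁻¹y⁻¹≡1 (λ ())) (*-identityʳ (inv x * inv y))
    where
    interchange : ∀ a b c d → (a * b) * (c * d) ≡ (a * c) * (b * d)
    interchange = solve-∀ ℚ-ring
    xy*x⁻¹y⁻¹≡1 : x * y * (inv x * inv y) ≡ 1ℚ
    xy*x⁻¹y⁻¹≡1 = trans (interchange x y (inv x) (inv y)) (cong₂ _*_ (inv-inverseʳ x≢0) (inv-inverseʳ y≢0))

*-congˡ-on-support : ∀ {n k c x y} → (n < k → c ≡ 0ℚ) → (k ≤ n → x ≡ y) → c * x ≡ c * y
*-congˡ-on-support {n} {k} {c} {x} {y} c≡0 x≡y with k ℕ.≤? n
... | yes k≤n = cong (c *_) (x≡y k≤n)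
... | no  k≰n = begin
  c * x    ≡⟨ cong (_* x) (c≡0 (ℕ.≰⇒> k≰n)) ⟩
  0ℚ * x   ≡⟨ *-zeroˡ x ⟩
  0ℚ       ≡⟨ sym (*-zeroˡ y) ⟩
  0ℚ * y   ≡⟨ cong (_* y) (sym (c≡0 (ℕ.≰⇒> k≰n))) ⟩
  c * y    ∎

*-≤-squares : ∀ s t → s ℕ.* t ≤ s ℕ.* s ℕ.+ t ℕ.* t
*-≤-squares s t with ℕ.≤-total s t
... | inj₁ s≤t = ℕ.≤-trans (ℕ.*-monoˡ-≤ t s≤t) (ℕ.m≤n+m (t ℕ.* t) (s ℕ.* s))
... | inj₂ t≤s = ℕ.≤-trans (ℕ.*-monoʳ-≤ s t≤s) (ℕ.m≤m+n (s ℕ.* s) (t ℕ.* t))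

qexp-+-* : ∀ s t → qexp s t ℕ.+ s ℕ.* t ≡ s ℕ.* s ℕ.+ t ℕ.* t
qexp-+-* s t = ℕ.m∸n+n≡m (*-≤-squares s t)

qexp-unique : ∀ s t {n} → n ℕ.+ s ℕ.* t ≡ s ℕ.* s ℕ.+ t ℕ.* t → qexp s t ≡ n
qexp-unique s t eq = ℕ.+-cancelʳ-≡ (s ℕ.* t) _ _ (trans (qexp-+-* s t) (sym eq))

qexp-zeroʳ : ∀ s → qexp s 0 ≡ s ℕ.* s
qexp-zeroʳ s = qexp-unique s 0 (s*0-vanishes s)
  where
  s*0-vanishes : ∀ s → s ℕ.* s ℕ.+ s ℕ.* 0 ≡ s ℕ.* s ℕ.+ 0 ℕ.* 0
  s*0-vanishes = ℕ-Solver.solve-∀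

qexp-suc-suc : ∀ s t → qexp (suc s) (suc t) ≡ qexp s t ℕ.+ suc t ℕ.+ s
qexp-suc-suc s t = qexp-unique (suc s) (suc t) (begin
  qexp s t ℕ.+ suc t ℕ.+ s ℕ.+ suc s ℕ.* suc t     ≡⟨ regroup (qexp s t) s t ⟩
  qexp s t ℕ.+ s ℕ.* t ℕ.+ 2 ℕ.* suc (s ℕ.+ t)      ≡⟨ cong (ℕ._+ 2 ℕ.* suc (s ℕ.+ t)) (qexp-+-* s t) ⟩
  s ℕ.* s ℕ.+ t ℕ.* t ℕ.+ 2 ℕ.* suc (s ℕ.+ t)       ≡⟨ complete-squares s t ⟩
  suc s ℕ.* suc s ℕ.+ suc t ℕ.* suc t               ∎)
  where
  regroup : ∀ x s t → x ℕ.+ suc t ℕ.+ s ℕ.+ suc s ℕ.* suc t ≡ x ℕ.+ s ℕ.* t ℕ.+ 2 ℕ.* suc (s ℕ.+ t)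
  regroup = ℕ-Solver.solve-∀
  complete-squares : ∀ s t → s ℕ.* s ℕ.+ t ℕ.* t ℕ.+ 2 ℕ.* suc (s ℕ.+ t) ≡ suc s ℕ.* suc s ℕ.+ suc t ℕ.* suc t
  complete-squares = ℕ-Solver.solve-∀

qexp-sucʳ : ∀ s t → qexp s (suc t) ℕ.+ s ≡ qexp s t ℕ.+ t ℕ.+ suc t
qexp-sucʳ s t = ℕ.+-cancelʳ-≡ (s ℕ.* t) _ _ (begin
  qexp s (suc t) ℕ.+ s ℕ.+ s ℕ.* t           ≡⟨ ℕ.+-assoc (qexp s (suc t)) s (s ℕ.* t) ⟩
  qexp s (suc t) ℕ.+ (s ℕ.+ s ℕ.* t)         ≡⟨ cong (qexp s (suc t) ℕ.+_) (sym (ℕ.*-suc s t)) ⟩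
  qexp s (suc t) ℕ.+ s ℕ.* suc t             ≡⟨ qexp-+-* s (suc t) ⟩
  s ℕ.* s ℕ.+ suc t ℕ.* suc t                ≡⟨ expand s t ⟩
  s ℕ.* s ℕ.+ t ℕ.* t ℕ.+ (t ℕ.+ suc t)      ≡⟨ cong (ℕ._+ (t ℕ.+ suc t)) (sym (qexp-+-* s t)) ⟩
  qexp s t ℕ.+ s ℕ.* t ℕ.+ (t ℕ.+ suc t)     ≡⟨ regroup (qexp s t) (s ℕ.* t) t ⟩
  qexp s t ℕ.+ t ℕ.+ suc t ℕ.+ s ℕ.* t       ∎)
  where
  expand : ∀ s t → s ℕ.* s ℕ.+ suc t ℕ.* suc t ≡ s ℕ.* s ℕ.+ t ℕ.* t ℕ.+ (t ℕ.+ suc t)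
  expand = ℕ-Solver.solve-∀
  regroup : ∀ x y t → x ℕ.+ y ℕ.+ (t ℕ.+ suc t) ≡ x ℕ.+ t ℕ.+ suc t ℕ.+ y
  regroup = ℕ-Solver.solve-∀

≤-qexp : ∀ s t → s ≤ qexp s t
≤-qexp zero      t = z≤n
≤-qexp s@(suc _) t = ℕ.+-cancelʳ-≤ (s ℕ.* t) s (qexp s t) (subst (s ℕ.+ s ℕ.* t ≤_) (sym (qexp-+-* s t)) bound)
  where
  bound : s ℕ.+ s ℕ.* t ≤ s ℕ.* s ℕ.+ t ℕ.* t
  bound with t ℕ.<? s
  ... | yes t<s = subst (ℕ._≤ s ℕ.* s ℕ.+ t ℕ.* t) (ℕ.*-suc s t)
                        (ℕ.≤-trans (ℕ.*-monoʳ-≤ s t<s) (ℕ.m≤m+n (s ℕ.* s) (t ℕ.* t)))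
  ... | no  t≮s = ℕ.+-mono-≤ (ℕ.m≤m*n s s) (ℕ.*-monoˡ-≤ t (ℕ.≮⇒≥ t≮s))

module QBinomial (q : ℚ) where

  pow-suc-square : ∀ s → pow q (suc s ℕ.* suc s) ≡ pow q (s ℕ.* s) * pow q s * pow q (suc s)
  pow-suc-square s = pow-+₃ q (s ℕ.* s) s (suc s) (expand s)
    where
    expand : ∀ s → suc s ℕ.* suc s ≡ s ℕ.* s ℕ.+ s ℕ.+ suc s
    expand = ℕ-Solver.solve-∀

  pow-qexp-suc-suc : ∀ s t → pow q (qexp (suc s) (suc t)) ≡ pow q (qexp s t) * pow q (suc t) * pow q s
  pow-qexp-suc-suc s t = pow-+₃ q (qexp s t) (suc t) s (qexp-suc-suc s t)

  pow-qexp-sucʳ : ∀ s t → pow q (qexp s (suc t)) * pow q s ≡ pow q (qexp s t) * pow q t * pow q (suc t)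
  pow-qexp-sucʳ s t = trans (sym (pow-+ q (qexp s (suc t)) s)) (pow-+₃ q (qexp s t) t (suc t) (qexp-sucʳ s t))

  pow-qexp-vanishes : ∀ s t → pow q s ≡ 0ℚ → pow q (qexp s t) ≡ 0ℚ
  pow-qexp-vanishes s t qˢ≡0 = begin
    pow q (qexp s t)                 ≡⟨ sym (pow-∸ q (≤-qexp s t)) ⟩
    pow q s * pow q (qexp s t ∸ s)   ≡⟨ cong (_* pow q (qexp s t ∸ s)) qˢ≡0 ⟩
    0ℚ * pow q (qexp s t ∸ s)        ≡⟨ *-zeroˡ (pow q (qexp s t ∸ s)) ⟩
    0ℚ                               ∎

  poch-shift : ∀ x m n → poch (x * q * pow q m) q n ≡ poch (x * pow q (suc m)) q n
  poch-shift x m n = cong (λ y → poch y q n) (*-assoc x q (pow q m))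

  poch-tail : ∀ X x {k N} → k ≤ N →
              X * poch (x * pow q (suc k)) q (suc N ∸ k)
                ≡ (1ℚ - x * pow q (suc N)) * (X * poch (x * pow q (suc k)) q (N ∸ k))
  poch-tail X x {k} {N} k≤N = trans (cong (X *_) (poch-∸-sucʳ x q (s≤s k≤N)))
                                    (regroup X (poch (x * pow q (suc k)) q (N ∸ k)) (x * pow q (suc N)))
    where
    regroup : ∀ a p y → a * (p * (1ℚ - y)) ≡ (1ℚ - y) * (a * p)
    regroup = solve-∀ ℚ-ring

  poch-head : ∀ x k n → poch (x * pow q (suc k)) q (suc n) ≡ (1ℚ - x * pow q (suc k)) * poch (x * q * pow q (suc k)) q n
  poch-head x k n = trans (poch-sucˡ (x * pow q (suc k)) q n)
                          (cong (λ y → (1ℚ - x * pow q (suc k)) * poch y q n) (swap x (pow q (suc k)) q))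
    where
    swap : ∀ a b c → a * b * c ≡ a * c * b
    swap = solve-∀ ℚ-ring

  poch-head≡tail : ∀ x {k N} → k ≤ N →
    (1ℚ - x * pow q (suc N)) * poch (x * pow q (suc k)) q (N ∸ k)
      ≡ (1ℚ - x * pow q (suc k)) * poch (x * q * pow q (suc k)) q (N ∸ k)
  poch-head≡tail x {k} {N} k≤N = begin
    (1ℚ - x * pow q (suc N)) * poch y q (N ∸ k)   ≡⟨ *-comm _ (poch y q (N ∸ k)) ⟩
    poch y q (N ∸ k) * (1ℚ - x * pow q (suc N))   ≡⟨ sym (poch-∸-sucʳ x q (s≤s k≤N)) ⟩
    poch y q (suc N ∸ k)                          ≡⟨ cong (poch y q) (ℕ.+-∸-assoc 1 k≤N) ⟩
    poch y q (suc (N ∸ k))                        ≡⟨ poch-head x k (N ∸ k) ⟩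
    (1ℚ - y) * poch (x * q * pow q (suc k)) q (N ∸ k) ∎
    where
    y = x * pow q (suc k)

  -- The truncation in n ∸ k is harmless: qbinom n k = 0 for k > n.
  qbinom : ℕ → ℕ → ℚ
  qbinom n       zero    = 1ℚ
  qbinom zero    (suc k) = 0ℚ
  qbinom (suc n) (suc k) = qbinom n (suc k) + pow q (n ∸ k) * qbinom n k

  qbinom-above : ∀ {n k} → n < k → qbinom n k ≡ 0ℚ
  qbinom-above {zero}  {suc k} _         = refl
  qbinom-above {suc n} {suc k} (s≤s n<k) = begin
    qbinom n (suc k) + pow q (n ∸ k) * qbinom n k
      ≡⟨ cong₂ (λ u v → u + pow q (n ∸ k) * v) (qbinom-above (ℕ.m≤n⇒m≤1+n n<k)) (qbinom-above n<k) ⟩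
    0ℚ + pow q (n ∸ k) * 0ℚ
      ≡⟨ cong (0ℚ +_) (*-zeroʳ (pow q (n ∸ k))) ⟩
    0ℚ ∎

  qbinom-*-cong : ∀ n k {x y} → (k ≤ n → x ≡ y) → qbinom n k * x ≡ qbinom n k * y
  qbinom-*-cong n k = *-congˡ-on-support qbinom-above

  qbinom-absorb : ∀ n k → (1ℚ - pow q (suc k)) * qbinom (suc n) (suc k) ≡ (1ℚ - pow q (suc n)) * qbinom n k
  qbinom-shiftʳ : ∀ n k → (1ℚ - pow q (suc k)) * qbinom n (suc k) ≡ (1ℚ - pow q (n ∸ k)) * qbinom n k

  qbinom-absorb n k = begin
    (1ℚ - E) * (X + w * C)               ≡⟨ distrib E X w C ⟩
    (1ℚ - E) * X + w * ((1ℚ - E) * C)    ≡⟨ cong (_+ w * ((1ℚ - E) * C)) (qbinom-shiftʳ n k) ⟩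
    (1ℚ - w) * C + w * ((1ℚ - E) * C)    ≡⟨ collect w E C ⟩
    C * (1ℚ - w * E)                     ≡⟨ qbinom-*-cong n k (λ k≤n → cong (λ x → 1ℚ - x) (pow-∸-suc q k≤n)) ⟩
    C * (1ℚ - pow q (suc n))             ≡⟨ *-comm C _ ⟩
    (1ℚ - pow q (suc n)) * C             ∎
    where
    E = pow q (suc k)
    X = qbinom n (suc k)
    C = qbinom n k
    w = pow q (n ∸ k)
    distrib : ∀ e x w c → (1ℚ - e) * (x + w * c) ≡ (1ℚ - e) * x + w * ((1ℚ - e) * c)
    distrib = solve-∀ ℚ-ring
    collect : ∀ w e c → (1ℚ - w) * c + w * ((1ℚ - e) * c) ≡ c * (1ℚ - w * e)
    collect = solve-∀ ℚ-ring

  qbinom-shiftʳ zero    zero    = *-zeroʳ (1ℚ - pow q 1)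
  qbinom-shiftʳ zero    (suc k) = *-zeroʳ (1ℚ - pow q (suc (suc k)))
  qbinom-shiftʳ (suc n) zero    = qbinom-absorb n zero
  qbinom-shiftʳ (suc n) (suc k) = begin
    (1ℚ - pow q (suc (suc k))) * qbinom (suc n) (suc (suc k))   ≡⟨ qbinom-absorb n (suc k) ⟩
    (1ℚ - pow q (suc n)) * X                                     ≡⟨ *-comm _ X ⟩
    X * (1ℚ - pow q (suc n))                                     ≡⟨ qbinom-*-cong n (suc k) qⁿ⁺¹≡w*E ⟩
    X * (1ℚ - w * E)                                             ≡⟨ collect w E X ⟩
    (1ℚ - w) * X + w * ((1ℚ - E) * X)                            ≡⟨ cong (λ z → (1ℚ - w) * X + w * z) (qbinom-shiftʳ n k) ⟩
    (1ℚ - w) * X + w * ((1ℚ - w) * C)                            ≡⟨ distrib w X C ⟩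
    (1ℚ - w) * (X + w * C)                                       ∎
    where
    E = pow q (suc k)
    X = qbinom n (suc k)
    C = qbinom n k
    w = pow q (n ∸ k)
    qⁿ⁺¹≡w*E : suc k ≤ n → 1ℚ - pow q (suc n) ≡ 1ℚ - w * E
    qⁿ⁺¹≡w*E k<n = cong (λ x → 1ℚ - x) (sym (pow-∸-suc q (ℕ.<⇒≤ k<n)))
    collect : ∀ w e x → x * (1ℚ - w * e) ≡ (1ℚ - w) * x + w * ((1ℚ - e) * x)
    collect = solve-∀ ℚ-ring
    distrib : ∀ w x c → (1ℚ - w) * x + w * ((1ℚ - w) * c) ≡ (1ℚ - w) * (x + w * c)
    distrib = solve-∀ ℚ-ring

  -- qFalling n k = (1 - q^n)(1 - q^(n-1)) ⋯ (1 - q^(n-k+1)) = (q^(n-k+1); q)_k for k ≤ n.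
  qFalling : ℕ → ℕ → ℚ
  qFalling n k = qbinom n k * poch q q k

  qFalling-above : ∀ {n k} → n < k → qFalling n k ≡ 0ℚ
  qFalling-above {k = k} n<k = trans (cong (_* poch q q k) (qbinom-above n<k)) (*-zeroˡ (poch q q k))

  qFalling-suc-suc : ∀ n k → qFalling (suc n) (suc k) ≡ (1ℚ - pow q (suc n)) * qFalling n k
  qFalling-suc-suc n k = begin
    X * (P * (1ℚ - pow q (suc k)))        ≡⟨ regroup X P (pow q (suc k)) ⟩
    P * ((1ℚ - pow q (suc k)) * X)        ≡⟨ cong (P *_) (qbinom-absorb n k) ⟩
    P * ((1ℚ - pow q (suc n)) * C)        ≡⟨ regroup′ P (pow q (suc n)) C ⟩
    (1ℚ - pow q (suc n)) * qFalling n k   ∎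
    where
    X = qbinom (suc n) (suc k)
    C = qbinom n k
    P = poch q q k
    regroup : ∀ b p e → b * (p * (1ℚ - e)) ≡ p * ((1ℚ - e) * b)
    regroup = solve-∀ ℚ-ring
    regroup′ : ∀ p e b → p * ((1ℚ - e) * b) ≡ (1ℚ - e) * (b * p)
    regroup′ = solve-∀ ℚ-ring

  pow-*-qFalling-suc : ∀ n k → pow q k * qFalling n (suc k) ≡ qFalling n k * (pow q k - pow q n)
  pow-*-qFalling-suc n k = begin
    pow q k * (X * (P * (1ℚ - pow q (suc k))))   ≡⟨ regroup (pow q k) X P (pow q (suc k)) ⟩
    P * pow q k * ((1ℚ - pow q (suc k)) * X)     ≡⟨ cong (P * pow q k *_) (qbinom-shiftʳ n k) ⟩
    P * pow q k * ((1ℚ - w) * C)                 ≡⟨ regroup′ P (pow q k) w C ⟩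
    qFalling n k * (pow q k - pow q k * w)       ≡⟨ *-congˡ-on-support {n} {k} qFalling-above qᵏ*w≡qⁿ ⟩
    qFalling n k * (pow q k - pow q n)           ∎
    where
    X = qbinom n (suc k)
    C = qbinom n k
    P = poch q q k
    w = pow q (n ∸ k)
    qᵏ*w≡qⁿ : k ≤ n → pow q k - pow q k * w ≡ pow q k - pow q n
    qᵏ*w≡qⁿ k≤n = cong (λ x → pow q k - x) (pow-∸ q k≤n)
    regroup : ∀ e x p f → e * (x * (p * (1ℚ - f))) ≡ p * e * ((1ℚ - f) * x)
    regroup = solve-∀ ℚ-ring
    regroup′ : ∀ p e w c → p * e * ((1ℚ - w) * c) ≡ c * p * (e - e * w)
    regroup′ = solve-∀ ℚ-ring

  qFalling-* : ∀ {n k} → k ≤ n → qFalling n k * poch q q (n ∸ k) ≡ poch q q n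
  qFalling-* {n}     {zero}  z≤n       = *-identityˡ (poch q q n)
  qFalling-* {suc n} {suc k} (s≤s k≤n) = begin
    qFalling (suc n) (suc k) * P                ≡⟨ cong (_* P) (qFalling-suc-suc n k) ⟩
    (1ℚ - pow q (suc n)) * qFalling n k * P     ≡⟨ *-assoc (1ℚ - pow q (suc n)) (qFalling n k) P ⟩
    (1ℚ - pow q (suc n)) * (qFalling n k * P)   ≡⟨ cong ((1ℚ - pow q (suc n)) *_) (qFalling-* k≤n) ⟩
    (1ℚ - pow q (suc n)) * poch q q n           ≡⟨ *-comm (1ℚ - pow q (suc n)) (poch q q n) ⟩
    poch q q (suc n)                            ∎
    where
    P = poch q q (n ∸ k)

  qbinomSum : ℕ → (ℕ → ℚ) → ℚ
  qbinomSum N g = sumTo N (λ k → qbinom N k * g k)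

  qbinomSum-cong : ∀ N {f g : ℕ → ℚ} → (∀ k → k ≤ N → f k ≡ g k) → qbinomSum N f ≡ qbinomSum N g
  qbinomSum-cong N f≗g = sumTo-cong N (λ k k≤N → cong (qbinom N k *_) (f≗g k k≤N))

  qbinomSum-factor : ∀ N c {f g : ℕ → ℚ} → (∀ k → k ≤ N → f k ≡ c * g k) → qbinomSum N f ≡ c * qbinomSum N g
  qbinomSum-factor N c {g = g} f≗cg = sumTo-factor N c (λ k k≤N →
    trans (cong (qbinom N k *_) (f≗cg k k≤N)) (swap (qbinom N k) c (g k)))
    where
    swap : ∀ a b x → a * (b * x) ≡ b * (a * x)
    swap = solve-∀ ℚ-ring

  qbinomSum-*ˡ : ∀ N c (f : ℕ → ℚ) → qbinomSum N (λ k → c * f k) ≡ c * qbinomSum N f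
  qbinomSum-*ˡ N c f = qbinomSum-factor N c (λ _ _ → refl)

  qbinomSum-+ : ∀ N (f g : ℕ → ℚ) → qbinomSum N (λ k → f k + g k) ≡ qbinomSum N f + qbinomSum N g
  qbinomSum-+ N f g = trans (sumTo-cong N (λ k _ → *-distribˡ-+ (qbinom N k) (f k) (g k))) (sumTo-+ N _ _)

  qbinomSum-zero : ∀ N (g : ℕ → ℚ) → (∀ k → g k ≡ 0ℚ) → qbinomSum N g ≡ 0ℚ
  qbinomSum-zero N g g≡0 =
    sumTo-zero N _ (λ k → trans (cong (qbinom N k *_) (g≡0 k)) (*-zeroʳ (qbinom N k)))

  qbinomSum-suc : ∀ N g → qbinomSum (suc N) g ≡ qbinomSum N g + qbinomSum N (λ k → pow q (N ∸ k) * g (suc k))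
  qbinomSum-suc N g = begin
    qbinomSum (suc N) g
      ≡⟨ sumTo-unfoldˡ N _ ⟩
    1ℚ * g 0 + sumTo N (λ k → (X k + w k * C k) * g (suc k))
      ≡⟨ cong (1ℚ * g 0 +_) (trans (sumTo-cong N (λ k _ → distrib (X k) (w k) (C k) (g (suc k))))
                                   (sumTo-+ N _ _)) ⟩
    1ℚ * g 0 + (sumTo N (λ k → X k * g (suc k)) + Σshifted)
      ≡⟨ sym (+-assoc (1ℚ * g 0) _ _) ⟩
    1ℚ * g 0 + sumTo N (λ k → X k * g (suc k)) + Σshifted
      ≡⟨ cong (_+ Σshifted) (sym unfold-below) ⟩
    qbinomSum N g + Σshifted
      ∎
    where
    X C w : ℕ → ℚ
    X k = qbinom N (suc k)
    C k = qbinom N k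
    w k = pow q (N ∸ k)
    Σshifted = qbinomSum N (λ k → w k * g (suc k))
    distrib : ∀ x w c g → (x + w * c) * g ≡ x * g + c * (w * g)
    distrib = solve-∀ ℚ-ring
    top-vanishes : qbinom N (suc N) * g (suc N) ≡ 0ℚ
    top-vanishes = trans (cong (_* g (suc N)) (qbinom-above (ℕ.n<1+n N))) (*-zeroˡ (g (suc N)))
    unfold-below : qbinomSum N g ≡ 1ℚ * g 0 + sumTo N (λ k → X k * g (suc k))
    unfold-below = begin
      qbinomSum N g                               ≡⟨ sym (+-identityʳ _) ⟩
      qbinomSum N g + 0ℚ                          ≡⟨ cong (qbinomSum N g +_) (sym top-vanishes) ⟩
      sumTo (suc N) (λ k → qbinom N k * g k)      ≡⟨ sumTo-unfoldˡ N _ ⟩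
      1ℚ * g 0 + sumTo N (λ k → X k * g (suc k))  ∎

  -- As q → 1, binomialTerm A M s → A^s (1 - A)^(M-s), so qbinomSum-binomial is the statement that the
  -- binomial probabilities sum to 1, and qbinomSum-moment computes the k-th factorial moment.
  binomialTerm : ℚ → ℕ → ℕ → ℚ
  binomialTerm A M s = pow A s * pow q (s ℕ.* s) * poch (A * pow q (suc s)) q (M ∸ s)

  binomialTerm-sucˡ : ∀ A {M s} → s ≤ M →
                      binomialTerm A (suc M) s ≡ (1ℚ - A * pow q (suc M)) * binomialTerm A M s
  binomialTerm-sucˡ A {s = s} = poch-tail (pow A s * pow q (s ℕ.* s)) A

  binomialTerm-sucʳ : ∀ A {M s} → s ≤ M →
                      pow q (M ∸ s) * binomialTerm A (suc M) (suc s) ≡ A * pow q (suc M) * binomialTerm (A * q) M s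
  binomialTerm-sucʳ A {M} {s} s≤M = begin
    pow q (M ∸ s) * (A * pow A s * pow q (suc s ℕ.* suc s) * P)
      ≡⟨ cong (λ z → pow q (M ∸ s) * (A * pow A s * z * P)) (pow-suc-square s) ⟩
    pow q (M ∸ s) * (A * pow A s * (pow q (s ℕ.* s) * pow q s * pow q (suc s)) * P)
      ≡⟨ regroup (pow q (M ∸ s)) A (pow A s) (pow q (s ℕ.* s)) (pow q s) (pow q (suc s)) P ⟩
    A * (pow q (M ∸ s) * pow q (suc s)) * (pow A s * pow q s * pow q (s ℕ.* s) * P)
      ≡⟨ cong₃ (λ u v w → A * u * (v * pow q (s ℕ.* s) * w))
               (pow-∸-suc q s≤M) (sym (pow-* A q s)) (sym (poch-shift A (suc s) (M ∸ s))) ⟩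
    A * pow q (suc M) * binomialTerm (A * q) M s ∎
    where
    P = poch (A * pow q (suc (suc s))) q (M ∸ s)
    regroup : ∀ w a as e es es1 p → w * (a * as * (e * es * es1) * p) ≡ a * (w * es1) * (as * es * e * p)
    regroup = solve-∀ ℚ-ring

  qbinomSum-binomial : ∀ M A → qbinomSum M (binomialTerm A M) ≡ 1ℚ
  qbinomSum-binomial zero    A = refl
  qbinomSum-binomial (suc M) A = begin
    qbinomSum (suc M) (binomialTerm A (suc M))
      ≡⟨ qbinomSum-suc M _ ⟩
    qbinomSum M (binomialTerm A (suc M)) + qbinomSum M (λ s → pow q (M ∸ s) * binomialTerm A (suc M) (suc s))
      ≡⟨ cong₂ _+_ (qbinomSum-factor M (1ℚ - x) (λ s → binomialTerm-sucˡ A))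
                   (qbinomSum-factor M x (λ s → binomialTerm-sucʳ A)) ⟩
    (1ℚ - x) * qbinomSum M (binomialTerm A M) + x * qbinomSum M (binomialTerm (A * q) M)
      ≡⟨ cong₂ (λ u v → (1ℚ - x) * u + x * v) (qbinomSum-binomial M A) (qbinomSum-binomial M (A * q)) ⟩
    (1ℚ - x) * 1ℚ + x * 1ℚ
      ≡⟨ partition x ⟩
    1ℚ ∎
    where
    x = A * pow q (suc M)
    partition : ∀ x → (1ℚ - x) * 1ℚ + x * 1ℚ ≡ 1ℚ
    partition = solve-∀ ℚ-ring

  momentTerm : ℕ → ℚ → ℕ → ℕ → ℚ
  momentTerm k A M s = qFalling s k * pow A s * pow q (qexp s k) * poch (A * pow q (suc s)) q (M ∸ s)

  qbinom-momentTerm-suc : ∀ k A M s →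
    qbinom (suc M) (suc s) * momentTerm (suc k) A (suc M) (suc s)
      ≡ (1ℚ - pow q (suc M)) * A * pow q (suc k) * (qbinom M s * momentTerm k (A * q) M s)
  qbinom-momentTerm-suc k A M s = begin
    X * (qFalling (suc s) (suc k) * (A * pow A s) * pow q (qexp (suc s) (suc k)) * P)
      ≡⟨ cong₂ (λ u v → X * (u * (A * pow A s) * v * P)) (qFalling-suc-suc s k) (pow-qexp-suc-suc s k) ⟩
    X * ((1ℚ - pow q (suc s)) * F * (A * pow A s) * (E * pow q (suc k) * pow q s) * P)
      ≡⟨ regroup X (pow q (suc s)) F A (pow A s) E (pow q (suc k)) (pow q s) P ⟩
    (1ℚ - pow q (suc s)) * X * A * pow q (suc k) * (F * (pow A s * pow q s) * E * P)
      ≡⟨ cong₃ (λ u v w → u * A * pow q (suc k) * (F * v * E * w))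
               (qbinom-absorb M s) (sym (pow-* A q s)) (sym (poch-shift A (suc s) (M ∸ s))) ⟩
    (1ℚ - pow q (suc M)) * qbinom M s * A * pow q (suc k) * momentTerm k (A * q) M s
      ≡⟨ regroup′ (pow q (suc M)) (qbinom M s) A (pow q (suc k)) (momentTerm k (A * q) M s) ⟩
    (1ℚ - pow q (suc M)) * A * pow q (suc k) * (qbinom M s * momentTerm k (A * q) M s) ∎
    where
    X = qbinom (suc M) (suc s)
    F = qFalling s k
    E = pow q (qexp s k)
    P = poch (A * pow q (suc (suc s))) q (M ∸ s)
    regroup : ∀ x f′ f a as e ek es p →
              x * ((1ℚ - f′) * f * (a * as) * (e * ek * es) * p) ≡ (1ℚ - f′) * x * a * ek * (f * (as * es) * e * p)
    regroup = solve-∀ ℚ-ring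
    regroup′ : ∀ m b a ek t → (1ℚ - m) * b * a * ek * t ≡ (1ℚ - m) * a * ek * (b * t)
    regroup′ = solve-∀ ℚ-ring

  qbinomSum-moment : ∀ k M A → qbinomSum M (momentTerm k A M) ≡ qFalling M k * pow A k * pow q (k ℕ.* k)
  qbinomSum-moment zero M A = trans (qbinomSum-cong M (λ s _ → momentTerm-zero s)) (qbinomSum-binomial M A)
    where
    momentTerm-zero : ∀ s → momentTerm 0 A M s ≡ binomialTerm A M s
    momentTerm-zero s = cong₂ (λ u v → u * v * poch (A * pow q (suc s)) q (M ∸ s))
                              (*-identityˡ (pow A s)) (cong (pow q) (qexp-zeroʳ s))
  qbinomSum-moment (suc k) zero A =
    vanish (poch q q (suc k)) (pow q (qexp 0 (suc k))) (pow A (suc k)) (pow q (suc k ℕ.* suc k))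
    where
    vanish : ∀ p e a e′ → 1ℚ * (0ℚ * p * 1ℚ * e * 1ℚ) ≡ 0ℚ * p * a * e′
    vanish = solve-∀ ℚ-ring
  qbinomSum-moment (suc k) (suc M) A = begin
    qbinomSum (suc M) (momentTerm (suc k) A (suc M))
      ≡⟨ sumTo-unfoldˡ M _ ⟩
    1ℚ * momentTerm (suc k) A (suc M) 0 + sumTo M (λ s → qbinom (suc M) (suc s) * momentTerm (suc k) A (suc M) (suc s))
      ≡⟨ cong₂ _+_ (vanish (poch q q (suc k)) (pow q (qexp 0 (suc k))) (poch (A * pow q 1) q (suc M)))
                   (sumTo-factor M c (λ s _ → qbinom-momentTerm-suc k A M s)) ⟩
    0ℚ + c * qbinomSum M (momentTerm k (A * q) M)
      ≡⟨ trans (+-identityˡ _) (cong (c *_) (qbinomSum-moment k M (A * q))) ⟩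
    c * (qFalling M k * pow (A * q) k * pow q (k ℕ.* k))
      ≡⟨ cong (λ u → c * (qFalling M k * u * pow q (k ℕ.* k))) (pow-* A q k) ⟩
    c * (qFalling M k * (pow A k * pow q k) * pow q (k ℕ.* k))
      ≡⟨ regroup (pow q (suc M)) A (pow q (suc k)) (qFalling M k) (pow A k) (pow q k) (pow q (k ℕ.* k)) ⟩
    (1ℚ - pow q (suc M)) * qFalling M k * (A * pow A k) * (pow q (k ℕ.* k) * pow q k * pow q (suc k))
      ≡⟨ sym (cong₂ (λ u v → u * (A * pow A k) * v) (qFalling-suc-suc M k) (pow-suc-square k)) ⟩
    qFalling (suc M) (suc k) * pow A (suc k) * pow q (suc k ℕ.* suc k) ∎
    where
    c = (1ℚ - pow q (suc M)) * A * pow q (suc k)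
    vanish : ∀ p e r → 1ℚ * (0ℚ * p * 1ℚ * e * r) ≡ 0ℚ
    vanish = solve-∀ ℚ-ring
    regroup : ∀ m a ek f ak qk qkk →
              (1ℚ - m) * a * ek * (f * (ak * qk) * qkk) ≡ (1ℚ - m) * f * (a * ak) * (qkk * qk * ek)
    regroup = solve-∀ ℚ-ring

  vandermondeTerm : ℕ → ℚ → ℕ → ℕ → ℚ
  vandermondeTerm m c n k = qFalling m k * pow c k * pow q (k ℕ.* k) * poch (c * pow q (suc k)) q (n ∸ k)

  vandermondeTerm-sucʳ : ∀ m c {n k} → k ≤ n →
    pow q (n ∸ k) * vandermondeTerm (suc m) c (suc n) (suc k)
      ≡ c * pow q (suc n) * (1ℚ - pow q (suc m)) * vandermondeTerm m (c * q) n k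
  vandermondeTerm-sucʳ m c {n} {k} k≤n = begin
    pow q (n ∸ k) * (qFalling (suc m) (suc k) * (c * pow c k) * pow q (suc k ℕ.* suc k) * P)
      ≡⟨ cong₂ (λ u v → pow q (n ∸ k) * (u * (c * pow c k) * v * P)) (qFalling-suc-suc m k) (pow-suc-square k) ⟩
    pow q (n ∸ k) * ((1ℚ - pow q (suc m)) * F * (c * pow c k) * (pow q (k ℕ.* k) * pow q k * pow q (suc k)) * P)
      ≡⟨ regroup (pow q (n ∸ k)) (pow q (suc m)) F c (pow c k) (pow q (k ℕ.* k)) (pow q k) (pow q (suc k)) P ⟩
    c * (pow q (n ∸ k) * pow q (suc k)) * (1ℚ - pow q (suc m)) * (F * (pow c k * pow q k) * pow q (k ℕ.* k) * P)
      ≡⟨ cong₃ (λ u v w → c * u * (1ℚ - pow q (suc m)) * (F * v * pow q (k ℕ.* k) * w))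
               (pow-∸-suc q k≤n) (sym (pow-* c q k)) (sym (poch-shift c (suc k) (n ∸ k))) ⟩
    c * pow q (suc n) * (1ℚ - pow q (suc m)) * vandermondeTerm m (c * q) n k ∎
    where
    F = qFalling m k
    P = poch (c * pow q (suc (suc k))) q (n ∸ k)
    regroup : ∀ w f′ f c ck e ek ek1 p →
              w * ((1ℚ - f′) * f * (c * ck) * (e * ek * ek1) * p)
                ≡ c * (w * ek1) * (1ℚ - f′) * (f * (ck * ek) * e * p)
    regroup = solve-∀ ℚ-ring

  q-Chu-Vandermonde : ∀ n m c → qbinomSum n (vandermondeTerm m c n) ≡ poch (c * pow q (suc m)) q n
  q-Chu-Vandermonde n zero c =
    trans (sumTo-head n _ (λ k → vanish (qbinom n (suc k)) (poch q q (suc k)) _ _ _))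
          (trans (*-identityˡ _) (*-identityˡ _))
    where
    vanish : ∀ b p x y z → b * (0ℚ * p * x * y * z) ≡ 0ℚ
    vanish = solve-∀ ℚ-ring
  q-Chu-Vandermonde zero    (suc m) c = refl
  q-Chu-Vandermonde (suc n) (suc m) c = begin
    qbinomSum (suc n) (vandermondeTerm (suc m) c (suc n))
      ≡⟨ qbinomSum-suc n _ ⟩
    qbinomSum n (vandermondeTerm (suc m) c (suc n))
      + qbinomSum n (λ k → pow q (n ∸ k) * vandermondeTerm (suc m) c (suc n) (suc k))
      ≡⟨ cong₂ _+_ (qbinomSum-factor n (1ℚ - x) (λ k → poch-tail (qFalling (suc m) k * pow c k * pow q (k ℕ.* k)) c))
                   (qbinomSum-factor n (x * (1ℚ - pow q (suc m))) (λ k → vandermondeTerm-sucʳ m c)) ⟩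
    (1ℚ - x) * qbinomSum n (vandermondeTerm (suc m) c n)
      + x * (1ℚ - pow q (suc m)) * qbinomSum n (vandermondeTerm m (c * q) n)
      ≡⟨ cong₂ (λ u v → (1ℚ - x) * u + x * (1ℚ - pow q (suc m)) * v)
               (q-Chu-Vandermonde n (suc m) c) (trans (q-Chu-Vandermonde n m (c * q)) (poch-shift c (suc m) n)) ⟩
    (1ℚ - x) * P + x * (1ℚ - pow q (suc m)) * P
      ≡⟨ collect c q (pow q n) (pow q m) P ⟩
    poch (c * pow q (suc (suc m))) q (suc n) ∎
    where
    x = c * pow q (suc n)
    P = poch (c * pow q (suc (suc m))) q n
    collect : ∀ c q qn qm p →
              (1ℚ - c * (q * qn)) * p + c * (q * qn) * (1ℚ - q * qm) * p ≡ p * (1ℚ - c * (q * (q * qm)) * qn)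
    collect = solve-∀ ℚ-ring

  module _ (s : ℕ) where

    transformLeft : ℚ → ℚ → ℕ → ℕ → ℚ
    transformLeft B C N t = pow B t * pow q (qexp s t) * poch (C * pow q (suc s)) q t
                            * poch (B * pow q (suc t)) q (N ∸ t) * poch (C * pow q (suc t)) q (N ∸ t)

    transformRight : ℚ → ℚ → ℕ → ℕ → ℚ
    transformRight B C N k = qFalling s k * pow B k * pow q (qexp s k) * poch (C * pow q (suc k)) q (N ∸ k)

    leftSum rightSum : ℕ → ℚ → ℚ → ℚ
    leftSum  N B C = qbinomSum N (transformLeft B C N)
    rightSum N B C = qbinomSum N (transformRight B C N)

    transformLeft-sucˡ : ∀ B C {N t} → t ≤ N →
      transformLeft B C (suc N) t ≡ (1ℚ - B * pow q (suc N)) * (1ℚ - C * pow q (suc N)) * transformLeft B C N t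
    transformLeft-sucˡ B C {N} {t} t≤N = begin
      Y * PB′ * PC′                           ≡⟨ poch-tail (Y * PB′) C t≤N ⟩
      (1ℚ - c) * (Y * PB′ * PC)               ≡⟨ cong (λ u → (1ℚ - c) * (u * PC)) (poch-tail Y B t≤N) ⟩
      (1ℚ - c) * ((1ℚ - b) * (Y * PB) * PC)   ≡⟨ regroup c b Y PB PC ⟩
      (1ℚ - b) * (1ℚ - c) * (Y * PB * PC)     ∎
      where
      Y = pow B t * pow q (qexp s t) * poch (C * pow q (suc s)) q t
      PB′ = poch (B * pow q (suc t)) q (suc N ∸ t)
      PC′ = poch (C * pow q (suc t)) q (suc N ∸ t)
      PB = poch (B * pow q (suc t)) q (N ∸ t)
      PC = poch (C * pow q (suc t)) q (N ∸ t)
      b = B * pow q (suc N)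
      c = C * pow q (suc N)
      regroup : ∀ c b y pb pc → (1ℚ - c) * ((1ℚ - b) * (y * pb) * pc) ≡ (1ℚ - b) * (1ℚ - c) * (y * pb * pc)
      regroup = solve-∀ ℚ-ring

    transformLeft-sucʳ : ∀ B C {N t} → t ≤ N →
      pow q s * (pow q (N ∸ t) * transformLeft B C (suc N) (suc t))
        ≡ B * pow q (suc N) * (1ℚ - C * pow q (suc s)) * transformLeft (B * q) (C * q) N t
    transformLeft-sucʳ B C {N} {t} t≤N = begin
      pow q s * (pow q (N ∸ t) * (B * pow B t * E′ * poch (C * pow q (suc s)) q (suc t) * PB * PC))
        ≡⟨ cong (λ u → pow q s * (pow q (N ∸ t) * (B * pow B t * E′ * u * PB * PC))) (poch-head C s t) ⟩
      pow q s * (pow q (N ∸ t) * (B * pow B t * E′ * ((1ℚ - Cs) * PCs) * PB * PC))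
        ≡⟨ regroup (pow q s) (pow q (N ∸ t)) B (pow B t) E′ Cs PCs PB PC ⟩
      E′ * pow q s * pow q (N ∸ t) * B * (1ℚ - Cs) * (pow B t * PCs * PB * PC)
        ≡⟨ cong (λ u → u * pow q (N ∸ t) * B * (1ℚ - Cs) * (pow B t * PCs * PB * PC)) (pow-qexp-sucʳ s t) ⟩
      E * pow q t * pow q (suc t) * pow q (N ∸ t) * B * (1ℚ - Cs) * (pow B t * PCs * PB * PC)
        ≡⟨ regroup′ E (pow q t) (pow q (suc t)) (pow q (N ∸ t)) B Cs (pow B t) PCs PB PC ⟩
      B * (pow q (N ∸ t) * pow q (suc t)) * (1ℚ - Cs) * (pow B t * pow q t * E * PCs * PB * PC)
        ≡⟨ cong₂ (λ u v → B * u * (1ℚ - Cs) * (v * E * PCs * PB * PC)) (pow-∸-suc q t≤N) (sym (pow-* B q t)) ⟩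
      B * pow q (suc N) * (1ℚ - Cs) * (pow (B * q) t * E * PCs * PB * PC)
        ≡⟨ cong₂ (λ u v → B * pow q (suc N) * (1ℚ - Cs) * (pow (B * q) t * E * PCs * u * v))
                 (sym (poch-shift B (suc t) (N ∸ t))) (sym (poch-shift C (suc t) (N ∸ t))) ⟩
      B * pow q (suc N) * (1ℚ - Cs) * transformLeft (B * q) (C * q) N t ∎
      where
      Cs = C * pow q (suc s)
      E = pow q (qexp s t)
      E′ = pow q (qexp s (suc t))
      PCs = poch (C * q * pow q (suc s)) q t
      PB = poch (B * pow q (suc (suc t))) q (N ∸ t)
      PC = poch (C * pow q (suc (suc t))) q (N ∸ t)
      regroup : ∀ qs w b bt e′ y pcs pb pc →
                qs * (w * (b * bt * e′ * ((1ℚ - y) * pcs) * pb * pc)) ≡ e′ * qs * w * b * (1ℚ - y) * (bt * pcs * pb * pc)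
      regroup = solve-∀ ℚ-ring
      regroup′ : ∀ e qt qt1 w b y bt pcs pb pc →
                 e * qt * qt1 * w * b * (1ℚ - y) * (bt * pcs * pb * pc)
                   ≡ b * (w * qt1) * (1ℚ - y) * (bt * qt * e * pcs * pb * pc)
      regroup′ = solve-∀ ℚ-ring

    transformRight-sucˡ : ∀ B C {N k} → k ≤ N →
      transformRight B C (suc N) k ≡ (1ℚ - C * pow q (suc N)) * transformRight B C N k
    transformRight-sucˡ B C {k = k} = poch-tail (qFalling s k * pow B k * pow q (qexp s k)) C

    transformRight-sucʳ : ∀ B C {N k} → k ≤ N →
      pow q s * (pow q (N ∸ k) * transformRight B C (suc N) (suc k))
        ≡ B * pow q (suc N) * (pow q k - pow q s) * transformRight B (C * q) N k
    transformRight-sucʳ B C {N} {k} k≤N = begin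
      pow q s * (pow q (N ∸ k) * (F′ * (B * pow B k) * E′ * PC))
        ≡⟨ regroup (pow q s) (pow q (N ∸ k)) F′ B (pow B k) E′ PC ⟩
      E′ * pow q s * pow q (N ∸ k) * F′ * B * (pow B k * PC)
        ≡⟨ cong (λ u → u * pow q (N ∸ k) * F′ * B * (pow B k * PC)) (pow-qexp-sucʳ s k) ⟩
      E * pow q k * pow q (suc k) * pow q (N ∸ k) * F′ * B * (pow B k * PC)
        ≡⟨ regroup′ E (pow q k) (pow q (suc k)) (pow q (N ∸ k)) F′ B (pow B k) PC ⟩
      B * (pow q (N ∸ k) * pow q (suc k)) * (pow q k * F′) * (pow B k * E * PC)
        ≡⟨ cong₂ (λ u v → B * u * v * (pow B k * E * PC)) (pow-∸-suc q k≤N) (pow-*-qFalling-suc s k) ⟩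
      B * pow q (suc N) * (F * (pow q k - pow q s)) * (pow B k * E * PC)
        ≡⟨ regroup″ (B * pow q (suc N)) F (pow q k - pow q s) (pow B k) E PC ⟩
      B * pow q (suc N) * (pow q k - pow q s) * (F * pow B k * E * PC)
        ≡⟨ cong (λ u → B * pow q (suc N) * (pow q k - pow q s) * (F * pow B k * E * u))
                (sym (poch-shift C (suc k) (N ∸ k))) ⟩
      B * pow q (suc N) * (pow q k - pow q s) * transformRight B (C * q) N k ∎
      where
      F = qFalling s k
      F′ = qFalling s (suc k)
      E = pow q (qexp s k)
      E′ = pow q (qexp s (suc k))
      PC = poch (C * pow q (suc (suc k))) q (N ∸ k)
      regroup : ∀ qs w f b bk e′ p → qs * (w * (f * (b * bk) * e′ * p)) ≡ e′ * qs * w * f * b * (bk * p)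
      regroup = solve-∀ ℚ-ring
      regroup′ : ∀ e qk qk1 w f b bk p → e * qk * qk1 * w * f * b * (bk * p) ≡ b * (w * qk1) * (qk * f) * (bk * e * p)
      regroup′ = solve-∀ ℚ-ring
      regroup″ : ∀ x f d bk e p → x * (f * d) * (bk * e * p) ≡ x * d * (f * bk * e * p)
      regroup″ = solve-∀ ℚ-ring

    transformRight-contiguous : ∀ B C {N k} → k ≤ N →
      - (B * pow q (suc N) * pow q s * (1ℚ - C * pow q (suc N))) * transformRight B C N k
        + B * pow q (suc N) * (1ℚ - C * pow q (suc s)) * transformRight (B * q) (C * q) N k
        ≡ B * pow q (suc N) * (pow q k - pow q s) * transformRight B (C * q) N k
    transformRight-contiguous B C {N} {k} k≤N = begin
      - (b * pow q s * (1ℚ - cN)) * (F * pow B k * E * PC) + b * (1ℚ - cs) * (F * pow (B * q) k * E * PCq)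
        ≡⟨ cong (λ u → - (b * pow q s * (1ℚ - cN)) * (F * pow B k * E * PC) + b * (1ℚ - cs) * (F * u * E * PCq))
                (pow-* B q k) ⟩
      - (b * pow q s * (1ℚ - cN)) * (F * pow B k * E * PC) + b * (1ℚ - cs) * (F * (pow B k * pow q k) * E * PCq)
        ≡⟨ regroup b (pow q s) cN F (pow B k) E PC cs (pow q k) PCq ⟩
      - (b * pow q s) * ((1ℚ - cN) * PC) * (F * pow B k * E) + b * (1ℚ - cs) * (F * (pow B k * pow q k) * E * PCq)
        ≡⟨ cong (λ u → - (b * pow q s) * u * (F * pow B k * E) + b * (1ℚ - cs) * (F * (pow B k * pow q k) * E * PCq))
                (poch-head≡tail C k≤N) ⟩
      - (b * pow q s) * ((1ℚ - C * pow q (suc k)) * PCq) * (F * pow B k * E)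
        + b * (1ℚ - cs) * (F * (pow B k * pow q k) * E * PCq)
        ≡⟨ collect b (pow q s) C q (pow q k) PCq F (pow B k) E ⟩
      b * (pow q k - pow q s) * transformRight B (C * q) N k ∎
      where
      b = B * pow q (suc N)
      cN = C * pow q (suc N)
      cs = C * pow q (suc s)
      F = qFalling s k
      E = pow q (qexp s k)
      PC = poch (C * pow q (suc k)) q (N ∸ k)
      PCq = poch (C * q * pow q (suc k)) q (N ∸ k)
      regroup : ∀ b qs cn f bk e pc cs qk pcq →
                - (b * qs * (1ℚ - cn)) * (f * bk * e * pc) + b * (1ℚ - cs) * (f * (bk * qk) * e * pcq)
                  ≡ - (b * qs) * ((1ℚ - cn) * pc) * (f * bk * e) + b * (1ℚ - cs) * (f * (bk * qk) * e * pcq)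
      regroup = solve-∀ ℚ-ring
      collect : ∀ b qs c q qk pcq f bk e →
                - (b * qs) * ((1ℚ - c * (q * qk)) * pcq) * (f * bk * e) + b * (1ℚ - c * (q * qs)) * (f * (bk * qk) * e * pcq)
                  ≡ b * (qk - qs) * (f * bk * e * pcq)
      collect = solve-∀ ℚ-ring

    leftSum-suc : ∀ N B C →
      pow q s * leftSum (suc N) B C
        ≡ pow q s * ((1ℚ - B * pow q (suc N)) * (1ℚ - C * pow q (suc N)) * leftSum N B C)
          + B * pow q (suc N) * (1ℚ - C * pow q (suc s)) * leftSum N (B * q) (C * q)
    leftSum-suc N B C = begin
      pow q s * leftSum (suc N) B C
        ≡⟨ cong (pow q s *_) (qbinomSum-suc N _) ⟩
      pow q s * (qbinomSum N (transformLeft B C (suc N)) + Σshifted)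
        ≡⟨ *-distribˡ-+ (pow q s) _ _ ⟩
      pow q s * qbinomSum N (transformLeft B C (suc N)) + pow q s * Σshifted
        ≡⟨ cong₂ _+_ (cong (pow q s *_) (qbinomSum-factor N K (λ t → transformLeft-sucˡ B C)))
                     (trans (sym (qbinomSum-*ˡ N (pow q s) _)) (qbinomSum-factor N K′ (λ t → transformLeft-sucʳ B C))) ⟩
      pow q s * (K * leftSum N B C) + K′ * leftSum N (B * q) (C * q) ∎
      where
      K = (1ℚ - B * pow q (suc N)) * (1ℚ - C * pow q (suc N))
      K′ = B * pow q (suc N) * (1ℚ - C * pow q (suc s))
      Σshifted = qbinomSum N (λ t → pow q (N ∸ t) * transformLeft B C (suc N) (suc t))

    rightSum-suc : ∀ N B C →
      pow q s * rightSum (suc N) B C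
        ≡ pow q s * ((1ℚ - B * pow q (suc N)) * (1ℚ - C * pow q (suc N)) * rightSum N B C)
          + B * pow q (suc N) * (1ℚ - C * pow q (suc s)) * rightSum N (B * q) (C * q)
    rightSum-suc N B C = begin
      pow q s * rightSum (suc N) B C
        ≡⟨ cong (pow q s *_) (qbinomSum-suc N _) ⟩
      pow q s * (qbinomSum N (transformRight B C (suc N)) + Σshifted)
        ≡⟨ *-distribˡ-+ (pow q s) _ _ ⟩
      pow q s * qbinomSum N (transformRight B C (suc N)) + pow q s * Σshifted
        ≡⟨ cong₂ _+_ (cong (pow q s *_) (qbinomSum-factor N (1ℚ - c) (λ k → transformRight-sucˡ B C)))
                     (trans (sym (qbinomSum-*ˡ N (pow q s) _)) (qbinomSum-cong N shifted-term)) ⟩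
      pow q s * ((1ℚ - c) * rightSum N B C) + qbinomSum N (λ k → L * transformRight B C N k + K′ * transformRight B′ C′ N k)
        ≡⟨ cong (pow q s * ((1ℚ - c) * rightSum N B C) +_)
                (trans (qbinomSum-+ N _ _) (cong₂ _+_ (qbinomSum-*ˡ N L _) (qbinomSum-*ˡ N K′ _))) ⟩
      pow q s * ((1ℚ - c) * rightSum N B C) + (L * rightSum N B C + K′ * rightSum N B′ C′)
        ≡⟨ collect (pow q s) b c (rightSum N B C) (K′ * rightSum N B′ C′) ⟩
      pow q s * ((1ℚ - b) * (1ℚ - c) * rightSum N B C) + K′ * rightSum N B′ C′ ∎
      where
      b = B * pow q (suc N)
      c = C * pow q (suc N)
      B′ = B * q
      C′ = C * q
      L = - (b * pow q s * (1ℚ - c))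
      K′ = b * (1ℚ - C * pow q (suc s))
      Σshifted = qbinomSum N (λ k → pow q (N ∸ k) * transformRight B C (suc N) (suc k))
      shifted-term : ∀ k → k ≤ N →
        pow q s * (pow q (N ∸ k) * transformRight B C (suc N) (suc k))
          ≡ L * transformRight B C N k + K′ * transformRight B′ C′ N k
      shifted-term k k≤N = trans (transformRight-sucʳ B C k≤N) (sym (transformRight-contiguous B C k≤N))
      collect : ∀ qs b c r z → qs * ((1ℚ - c) * r) + (- (b * qs * (1ℚ - c)) * r + z) ≡ qs * ((1ℚ - b) * (1ℚ - c) * r) + z
      collect = solve-∀ ℚ-ring

    leftSum≡rightSum-pow≢0 : pow q s ≢ 0ℚ → ∀ N B C → leftSum N B C ≡ rightSum N B C
    leftSum≡rightSum-pow≢0 qˢ≢0 zero B C = same-term (pow q (qexp s 0))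
      where
      same-term : ∀ e → 1ℚ * (1ℚ * e * 1ℚ * 1ℚ * 1ℚ) ≡ 1ℚ * (1ℚ * 1ℚ * e * 1ℚ)
      same-term = solve-∀ ℚ-ring
    leftSum≡rightSum-pow≢0 qˢ≢0 (suc N) B C = *-cancelˡ qˢ≢0 (begin
      pow q s * leftSum (suc N) B C
        ≡⟨ leftSum-suc N B C ⟩
      pow q s * (K * leftSum N B C) + K′ * leftSum N (B * q) (C * q)
        ≡⟨ cong₂ (λ u v → pow q s * (K * u) + K′ * v)
                 (leftSum≡rightSum-pow≢0 qˢ≢0 N B C) (leftSum≡rightSum-pow≢0 qˢ≢0 N (B * q) (C * q)) ⟩
      pow q s * (K * rightSum N B C) + K′ * rightSum N (B * q) (C * q)
        ≡⟨ sym (rightSum-suc N B C) ⟩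
      pow q s * rightSum (suc N) B C ∎)
      where
      K = (1ℚ - B * pow q (suc N)) * (1ℚ - C * pow q (suc N))
      K′ = B * pow q (suc N) * (1ℚ - C * pow q (suc s))

    -- Both sums satisfy the same recurrence only after multiplication by q^s; when q^s = 0
    -- every term vanishes instead, because qexp s t ≥ s.
    leftSum≡rightSum : ∀ N B C → leftSum N B C ≡ rightSum N B C
    leftSum≡rightSum N B C with pow q s ≟ 0ℚ
    ... | no  qˢ≢0 = leftSum≡rightSum-pow≢0 qˢ≢0 N B C
    ... | yes qˢ≡0 = trans (qbinomSum-zero N _ left-vanishes) (sym (qbinomSum-zero N _ right-vanishes))
      where
      left-vanishes : ∀ t → transformLeft B C N t ≡ 0ℚ
      left-vanishes t = trans (cong (λ e → pow B t * e * PCs * PB * PC) (pow-qexp-vanishes s t qˢ≡0))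
                              (vanish (pow B t) PCs PB PC)
        where
        PCs = poch (C * pow q (suc s)) q t
        PB = poch (B * pow q (suc t)) q (N ∸ t)
        PC = poch (C * pow q (suc t)) q (N ∸ t)
        vanish : ∀ a b c d → a * 0ℚ * b * c * d ≡ 0ℚ
        vanish = solve-∀ ℚ-ring
      right-vanishes : ∀ k → transformRight B C N k ≡ 0ℚ
      right-vanishes k = trans (cong (λ e → qFalling s k * pow B k * e * PC) (pow-qexp-vanishes s k qˢ≡0))
                               (vanish (qFalling s k) (pow B k) PC)
        where
        PC = poch (C * pow q (suc k)) q (N ∸ k)
        vanish : ∀ a b c → a * b * 0ℚ * c ≡ 0ℚ
        vanish = solve-∀ ℚ-ring

module ClearedDenominators (a b q : ℚ) (M₁ M₂ : ℕ) where
  open QBinomial q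

  denominator : ℚ
  denominator = poch q q M₁ * poch (a * q) q M₁ * poch (a * b * q) q M₁
                * (poch q q M₂ * poch (b * q) q M₂ * poch (a * b * q) q M₂)

  clearedTerm : ℕ → ℕ → ℚ
  clearedTerm r₁ r₂ =
    pow a r₁ * pow b r₂ * pow q (qexp r₁ r₂) * poch (a * b * q) q (r₁ ℕ.+ r₂)
    * (qbinom M₁ r₁ * qbinom M₂ r₂
       * (poch (a * q * pow q r₁) q (M₁ ∸ r₁) * poch (a * b * q * pow q r₁) q (M₁ ∸ r₁)
          * poch (b * q * pow q r₂) q (M₂ ∸ r₂) * poch (a * b * q * pow q r₂) q (M₂ ∸ r₂)))

  term≡clearedTerm/denominator : ∀ {r₁ r₂} → r₁ ≤ M₁ → r₂ ≤ M₂ → denominator ≢ 0ℚ →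
                                 term a b q M₁ M₂ r₁ r₂ ≡ inv denominator * clearedTerm r₁ r₂
  term≡clearedTerm/denominator {r₁} {r₂} r₁≤M₁ r₂≤M₂ D≢0 = begin
    A * inv U * (Pγ * inv Dr)             ≡⟨ regroup A (inv U) Pγ (inv Dr) ⟩
    A * Pγ * (inv U * inv Dr)             ≡⟨ cong (A * Pγ *_) (sym (inv-* U Dr)) ⟩
    A * Pγ * inv (U * Dr)                 ≡⟨ cong (A * Pγ *_) (inv-unique {U * Dr} U*Dr*Y≡D D≢0) ⟩
    A * Pγ * (Y * inv denominator)        ≡⟨ regroup′ (A * Pγ) Y (inv denominator) ⟩
    inv denominator * clearedTerm r₁ r₂   ∎
    where
    A = pow a r₁ * pow b r₂ * pow q (qexp r₁ r₂)
    Pγ = poch (a * b * q) q (r₁ ℕ.+ r₂)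
    U = poch q q (M₁ ∸ r₁) * poch q q (M₂ ∸ r₂)
    Dr = poch q q r₁ * poch (a * q) q r₁ * poch (a * b * q) q r₁
         * (poch q q r₂ * poch (b * q) q r₂ * poch (a * b * q) q r₂)
    Pa = poch (a * q * pow q r₁) q (M₁ ∸ r₁)
    Pγ₁ = poch (a * b * q * pow q r₁) q (M₁ ∸ r₁)
    Pb = poch (b * q * pow q r₂) q (M₂ ∸ r₂)
    Pγ₂ = poch (a * b * q * pow q r₂) q (M₂ ∸ r₂)
    Y = qbinom M₁ r₁ * qbinom M₂ r₂ * (Pa * Pγ₁ * Pb * Pγ₂)
    regroup : ∀ x u y d → x * u * (y * d) ≡ x * y * (u * d)
    regroup = solve-∀ ℚ-ring
    regroup′ : ∀ x y d → x * (y * d) ≡ d * (x * y)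
    regroup′ = solve-∀ ℚ-ring
    pair-up : ∀ u₁ u₂ q₁ a₁ γ₁ q₂ b₂ γ₂ c₁ c₂ pa pγ₁ pb pγ₂ →
              u₁ * u₂ * (q₁ * a₁ * γ₁ * (q₂ * b₂ * γ₂)) * (c₁ * c₂ * (pa * pγ₁ * pb * pγ₂))
                ≡ c₁ * q₁ * u₁ * (a₁ * pa) * (γ₁ * pγ₁) * (c₂ * q₂ * u₂ * (b₂ * pb) * (γ₂ * pγ₂))
    pair-up = solve-∀ ℚ-ring
    U*Dr*Y≡D : U * Dr * Y ≡ denominator
    U*Dr*Y≡D = begin
      U * Dr * Y
        ≡⟨ pair-up (poch q q (M₁ ∸ r₁)) (poch q q (M₂ ∸ r₂))
                   (poch q q r₁) (poch (a * q) q r₁) (poch (a * b * q) q r₁)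
                   (poch q q r₂) (poch (b * q) q r₂) (poch (a * b * q) q r₂)
                   (qbinom M₁ r₁) (qbinom M₂ r₂) Pa Pγ₁ Pb Pγ₂ ⟩
      qFalling M₁ r₁ * poch q q (M₁ ∸ r₁) * (poch (a * q) q r₁ * Pa) * (poch (a * b * q) q r₁ * Pγ₁)
        * (qFalling M₂ r₂ * poch q q (M₂ ∸ r₂) * (poch (b * q) q r₂ * Pb) * (poch (a * b * q) q r₂ * Pγ₂))
        ≡⟨ cong₂ _*_ (cong₃ (λ x y z → x * y * z) (qFalling-* r₁≤M₁) (poch-∸ (a * q) q r₁≤M₁) (poch-∸ (a * b * q) q r₁≤M₁))
                     (cong₃ (λ x y z → x * y * z) (qFalling-* r₂≤M₂) (poch-∸ (b * q) q r₂≤M₂) (poch-∸ (a * b * q) q r₂≤M₂)) ⟩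
      denominator ∎

  rowWeight : ℕ → ℚ
  rowWeight s = poch (a * b * q) q M₁ * (qbinom M₁ s * pow a s * poch (a * pow q (suc s)) q (M₁ ∸ s))

  columnWeight : ℕ → ℚ
  columnWeight k = poch (a * b * q) q M₁ * (qbinom M₂ k * pow b k * poch (a * b * pow q (suc k)) q (M₂ ∸ k))

  clearedTerm-row : ∀ {s} → s ≤ M₁ → ∀ t → clearedTerm s t ≡ rowWeight s * (qbinom M₂ t * transformLeft s b (a * b) M₂ t)
  clearedTerm-row {s} s≤M₁ t = begin
    A * poch (a * b * q) q (s ℕ.+ t) * (qbinom M₁ s * qbinom M₂ t * (Pa * Pγ₁ * Pb * Pγ₂))
      ≡⟨ cong (λ u → A * u * (qbinom M₁ s * qbinom M₂ t * (Pa * Pγ₁ * Pb * Pγ₂))) (poch-+ (a * b * q) q s t) ⟩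
    A * (poch (a * b * q) q s * Pγs) * (qbinom M₁ s * qbinom M₂ t * (Pa * Pγ₁ * Pb * Pγ₂))
      ≡⟨ regroup (pow a s) (pow b t) E (poch (a * b * q) q s) Pγs (qbinom M₁ s) (qbinom M₂ t) Pa Pγ₁ Pb Pγ₂ ⟩
    poch (a * b * q) q s * Pγ₁ * (qbinom M₁ s * pow a s * Pa) * (qbinom M₂ t * (pow b t * E * Pγs * Pb * Pγ₂))
      ≡⟨ cong₂ (λ u v → u * (qbinom M₁ s * pow a s * v) * (qbinom M₂ t * (pow b t * E * Pγs * Pb * Pγ₂)))
               (poch-∸ (a * b * q) q s≤M₁) (poch-shift a s (M₁ ∸ s)) ⟩
    rowWeight s * (qbinom M₂ t * (pow b t * E * Pγs * Pb * Pγ₂))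
      ≡⟨ cong₃ (λ u v w → rowWeight s * (qbinom M₂ t * (pow b t * E * u * v * w)))
               (poch-shift (a * b) s t) (poch-shift b t (M₂ ∸ t)) (poch-shift (a * b) t (M₂ ∸ t)) ⟩
    rowWeight s * (qbinom M₂ t * transformLeft s b (a * b) M₂ t) ∎
    where
    A = pow a s * pow b t * pow q (qexp s t)
    E = pow q (qexp s t)
    Pγs = poch (a * b * q * pow q s) q t
    Pa = poch (a * q * pow q s) q (M₁ ∸ s)
    Pγ₁ = poch (a * b * q * pow q s) q (M₁ ∸ s)
    Pb = poch (b * q * pow q t) q (M₂ ∸ t)
    Pγ₂ = poch (a * b * q * pow q t) q (M₂ ∸ t)
    regroup : ∀ as bt e γ γs b₁ b₂ pa pγ₁ pb pγ₂ →
              as * bt * e * (γ * γs) * (b₁ * b₂ * (pa * pγ₁ * pb * pγ₂))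
                ≡ γ * pγ₁ * (b₁ * as * pa) * (b₂ * (bt * e * γs * pb * pγ₂))
    regroup = solve-∀ ℚ-ring

  row-to-column : ∀ s k →
    rowWeight s * (qbinom M₂ k * transformRight s b (a * b) M₂ k) ≡ columnWeight k * (qbinom M₁ s * momentTerm k a M₁ s)
  row-to-column s k =
    regroup (poch (a * b * q) q M₁) (qbinom M₁ s) (pow a s) (poch (a * pow q (suc s)) q (M₁ ∸ s))
            (qbinom M₂ k) (qFalling s k) (pow b k) (pow q (qexp s k)) (poch (a * b * pow q (suc k)) q (M₂ ∸ k))
    where
    regroup : ∀ γ b₁ as pa b₂ f bk e pc →
              γ * (b₁ * as * pa) * (b₂ * (f * bk * e * pc)) ≡ γ * (b₂ * bk * pc) * (b₁ * (f * as * e * pa))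
    regroup = solve-∀ ℚ-ring

  column-vandermonde : ∀ k →
    columnWeight k * (qFalling M₁ k * pow a k * pow q (k ℕ.* k))
      ≡ poch (a * b * q) q M₁ * (qbinom M₂ k * vandermondeTerm M₁ (a * b) M₂ k)
  column-vandermonde k = begin
    columnWeight k * (qFalling M₁ k * pow a k * pow q (k ℕ.* k))
      ≡⟨ regroup (poch (a * b * q) q M₁) (qbinom M₂ k) (pow b k) Pc (qFalling M₁ k) (pow a k) (pow q (k ℕ.* k)) ⟩
    poch (a * b * q) q M₁ * (qbinom M₂ k * (qFalling M₁ k * (pow a k * pow b k) * pow q (k ℕ.* k) * Pc))
      ≡⟨ cong (λ u → poch (a * b * q) q M₁ * (qbinom M₂ k * (qFalling M₁ k * u * pow q (k ℕ.* k) * Pc)))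
              (sym (pow-* a b k)) ⟩
    poch (a * b * q) q M₁ * (qbinom M₂ k * vandermondeTerm M₁ (a * b) M₂ k) ∎
    where
    Pc = poch (a * b * pow q (suc k)) q (M₂ ∸ k)
    regroup : ∀ γ b₂ bk pc f ak e → γ * (b₂ * bk * pc) * (f * ak * e) ≡ γ * (b₂ * (f * (ak * bk) * e * pc))
    regroup = solve-∀ ℚ-ring

  clearedSum : sumTo M₁ (λ r₁ → sumTo M₂ (clearedTerm r₁)) ≡ poch (a * b * q) q (M₁ ℕ.+ M₂)
  clearedSum = begin
    sumTo M₁ (λ s → sumTo M₂ (clearedTerm s))
      ≡⟨ sumTo-cong M₁ (λ s s≤M₁ → trans (sumTo-factor M₂ (rowWeight s) (λ t _ → clearedTerm-row s≤M₁ t))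
                                          (cong (rowWeight s *_) (leftSum≡rightSum s M₂ b (a * b)))) ⟩
    sumTo M₁ (λ s → rowWeight s * rightSum s M₂ b (a * b))
      ≡⟨ sumTo-cong M₁ (λ s _ → sym (sumTo-*ˡ M₂ (rowWeight s) _)) ⟩
    sumTo M₁ (λ s → sumTo M₂ (λ k → rowWeight s * (qbinom M₂ k * transformRight s b (a * b) M₂ k)))
      ≡⟨ sumTo-comm M₁ M₂ _ ⟩
    sumTo M₂ (λ k → sumTo M₁ (λ s → rowWeight s * (qbinom M₂ k * transformRight s b (a * b) M₂ k)))
      ≡⟨ sumTo-cong M₂ (λ k _ → trans (sumTo-factor M₁ (columnWeight k) (λ s _ → row-to-column s k))
                                      (cong (columnWeight k *_) (qbinomSum-moment k M₁ a))) ⟩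
    sumTo M₂ (λ k → columnWeight k * (qFalling M₁ k * pow a k * pow q (k ℕ.* k)))
      ≡⟨ sumTo-factor M₂ (poch (a * b * q) q M₁) (λ k _ → column-vandermonde k) ⟩
    poch (a * b * q) q M₁ * qbinomSum M₂ (vandermondeTerm M₁ (a * b) M₂)
      ≡⟨ cong (poch (a * b * q) q M₁ *_)
              (trans (q-Chu-Vandermonde M₂ M₁ (a * b)) (sym (poch-shift (a * b) M₁ M₂))) ⟩
    poch (a * b * q) q M₁ * poch (a * b * q * pow q M₁) q M₂
      ≡⟨ sym (poch-+ (a * b * q) q M₁ M₂) ⟩
    poch (a * b * q) q (M₁ ℕ.+ M₂) ∎

theorem5p2 : (a b q : ℚ) (M₁ M₂ : ℕ)
    → poch q q M₁ ≢ 0ℚ → poch q q M₂ ≢ 0ℚ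
    → poch (a * q) q M₁ ≢ 0ℚ → poch (b * q) q M₂ ≢ 0ℚ
    → poch (a * b * q) q M₁ ≢ 0ℚ → poch (a * b * q) q M₂ ≢ 0ℚ
    → lhs a b q M₁ M₂ ≡ rhs a b q M₁ M₂
theorem5p2 a b q M₁ M₂ h₁ h₂ h₃ h₄ h₅ h₆ = begin
  lhs a b q M₁ M₂
    ≡⟨ sumTo-factor M₁ (inv denominator) (λ r₁ r₁≤M₁ →
         sumTo-factor M₂ (inv denominator) (λ r₂ r₂≤M₂ → term≡clearedTerm/denominator r₁≤M₁ r₂≤M₂ D≢0)) ⟩
  inv denominator * sumTo M₁ (λ r₁ → sumTo M₂ (clearedTerm r₁))
    ≡⟨ cong (inv denominator *_) clearedSum ⟩
  inv denominator * poch (a * b * q) q (M₁ ℕ.+ M₂)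
    ≡⟨ *-comm (inv denominator) _ ⟩
  rhs a b q M₁ M₂ ∎
  where
  open ClearedDenominators a b q M₁ M₂
  D≢0 : denominator ≢ 0ℚ
  D≢0 = *-≢0 (*-≢0 (*-≢0 h₁ h₃) h₅) (*-≢0 (*-≢0 h₂ h₄) h₆)
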